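{- Let $\mathcal F$ be an algebraic language with no nullary symbols, $\mathbf I=([m];\mathcal F)$ a finite $\mathcal F$-algebra, $\mathbf A$ an $\mathcal F$-algebra with a surjective homomorphism $\chi\colon\mathbf A\to\mathbf I$, and $\alpha:=\ker\chi$. For every congruence $\beta\le\alpha$ of $\mathbf A$, \[\mathfrak C(\mathbf A/\beta,\chi/\beta)\cong\mathfrak C(\mathbf A,\chi)/\beta^*,\] where $\chi/\beta\colon\mathbf A/\beta\to\mathbf I$ is the homomorphism with $\chi=(\chi/\beta)\circ\nu$, $\nu\colon\mathbf A\to\mathbf A/\beta$ the natural map.
   Context: $[m]=\{1,\dots,m\}$. For $(\mathbf B,\xi)$ with $\xi\colon\mathbf B\to\mathbf I$ onto and $D^{(i)}=\xi^{ -1}(i)$, $\mathfrak C(\mathbf B,\xi)$ has universe $C=D^{(1)}\times\dots\times D^{(m)}$ (columns $\mathbf c=(c^{(1)},\dots,c^{(m)})$), an $m$-ary operation $d(\mathbf c_1,\dots,\mathbf c_m)=(c_1^{(1)},\dots,c_m^{(m)})$, and for each $k$-ary $f\in\mathcal F$ and $\mathbf i\in[m]^k$ a $k$-ary operation $\hat f_{\mathbf i}(\mathbf c_1,\dots,\mathbf c_k)$: $\mathbf c_1$ with its $f^{\mathbf I}(\mathbf i)$-th entry replaced by $f^{\mathbf B}(c_1^{(i_1)},\dots,c_k^{(i_k)})$. For a congruence $\beta\le\ker\chi$ of $\mathbf A$, $\beta^*=\{(\mathbf a,\mathbf b)\in C^2:(a^{(i)},b^{(i)})\in\beta\ \forall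 i\}$ (a congruence of $\mathfrak C(\mathbf A,\chi)$). -}

module Defs where

open import Level using (Level; _⊔_; 0ℓ) renaming (suc to lsuc)
open import Data.Nat using (ℕ; _<_; zero; suc)
open import Data.Fin using (Fin; _≟_) renaming (zero to fzero)
open import Data.Product using (Σ; _,_; proj₁; proj₂)
open import Relation.Binary using (Rel; IsEquivalence)
open import Relation.Binary.PropositionalEquality as ≡ using (_≡_; refl)
open import Relation.Nullary using (yes; no)

record Signature : Set₁ where
  field
    Op    : Set
    arity : Op → ℕ
open Signature public

NoNullary : Signature → Set
NoNullary F = (f : Op F) → 0 < arity F f

first : ∀ {n} → 0 < n → Fin n
first {suc n} _ = fzero

record Algebra (F : Signature) (a ℓ : Level) : Set (lsuc (a ⊔ ℓ)) where
  field
    Carrier       : Set a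
    _≈_           : Rel Carrier ℓ
    isEquivalence : IsEquivalence _≈_
    ⟦_⟧           : (f : Op F) → (Fin (arity F f) → Carrier) → Carrier
    ⟦⟧-cong       : ∀ f {xs ys : Fin (arity F f) → Carrier} →
                    (∀ j → xs j ≈ ys j) → ⟦ f ⟧ xs ≈ ⟦ f ⟧ ys

record FinAlgebra (F : Signature) (m : ℕ) : Set where
  field
    op      : (f : Op F) → (Fin (arity F f) → Fin m) → Fin m
    op-cong : ∀ f {xs ys : Fin (arity F f) → Fin m} →
              (∀ j → xs j ≡ ys j) → op f xs ≡ op f ys

FinAlg : ∀ {F m} → FinAlgebra F m → Algebra F 0ℓ 0ℓ
FinAlg {F} {m} I = record
  { Carrier = Fin m
  ; _≈_ = _≡_
  ; isEquivalence = ≡.isEquivalence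
  ; ⟦_⟧ = FinAlgebra.op I
  ; ⟦⟧-cong = FinAlgebra.op-cong I
  }

record Hom {F : Signature} {a ℓ b ℓ′ : Level}
           (A : Algebra F a ℓ) (B : Algebra F b ℓ′) : Set (a ⊔ ℓ ⊔ b ⊔ ℓ′) where
  private
    module A = Algebra A
    module B = Algebra B
  field
    func      : A.Carrier → B.Carrier
    func-cong : ∀ {x y} → x A.≈ y → func x B.≈ func y
    func-hom  : ∀ f (xs : Fin (arity F f) → A.Carrier) →
                func (A.⟦ f ⟧ xs) B.≈ B.⟦ f ⟧ (λ j → func (xs j))

Surjective : ∀ {F a ℓ m} {A : Algebra F a ℓ} {I : FinAlgebra F m} →
             Hom A (FinAlg I) → Set a
Surjective {m = m} {A = A} χ = (i : Fin m) → Σ (Algebra.Carrier A) (λ x → Hom.func χ x ≡ i)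

record _≅_ {F : Signature} {a ℓ b ℓ′ : Level}
           (A : Algebra F a ℓ) (B : Algebra F b ℓ′) : Set (a ⊔ ℓ ⊔ b ⊔ ℓ′) where
  private
    module A = Algebra A
    module B = Algebra B
  field
    to      : Hom A B
    from    : Hom B A
    to∘from : ∀ y → Hom.func to (Hom.func from y) B.≈ y
    from∘to : ∀ x → Hom.func from (Hom.func to x) A.≈ x

record Congruence {F : Signature} {a ℓ : Level} (A : Algebra F a ℓ) (r : Level)
       : Set (a ⊔ ℓ ⊔ lsuc r) where
  private module A = Algebra A
  field
    rel           : Rel A.Carrier r
    isEquivalence : IsEquivalence rel
    ≈⊆rel         : ∀ {x y} → x A.≈ y → rel x y
    compatible    : ∀ f {xs ys : Fin (arity F f) → A.Carrier} →
                    (∀ j → rel (xs j) (ys j)) → rel (A.⟦ f ⟧ xs) (A.⟦ f ⟧ ys)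

_≤ᶜ_ : ∀ {F a ℓ r s} {A : Algebra F a ℓ} → Congruence A r → Congruence A s → Set (a ⊔ r ⊔ s)
θ ≤ᶜ ψ = ∀ {x y} → Congruence.rel θ x y → Congruence.rel ψ x y

ker : ∀ {F a ℓ m} {A : Algebra F a ℓ} {I : FinAlgebra F m} →
      Hom A (FinAlg I) → Congruence A 0ℓ
ker {A = A} {I = I} χ = record
  { rel = λ x y → func x ≡ func y
  ; isEquivalence = record { refl = refl ; sym = ≡.sym ; trans = ≡.trans }
  ; ≈⊆rel = func-cong
  ; compatible = λ f {xs} {ys} eq →
      ≡.trans (func-hom f xs)
        (≡.trans (FinAlgebra.op-cong I f eq) (≡.sym (func-hom f ys)))
  }
  where open Hom χ

_/_ : ∀ {F a ℓ r} (A : Algebra F a ℓ) → Congruence A r → Algebra F a r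
A / θ = record
  { Carrier = Algebra.Carrier A
  ; _≈_ = Congruence.rel θ
  ; isEquivalence = Congruence.isEquivalence θ
  ; ⟦_⟧ = Algebra.⟦_⟧ A
  ; ⟦⟧-cong = Congruence.compatible θ
  }

ν : ∀ {F a ℓ r} {A : Algebra F a ℓ} (θ : Congruence A r) → Hom A (A / θ)
ν {A = A} θ = record
  { func = λ x → x
  ; func-cong = Congruence.≈⊆rel θ
  ; func-hom = λ f xs → IsEquivalence.refl (Congruence.isEquivalence θ)
  }

quotHom : ∀ {F a ℓ r m} {A : Algebra F a ℓ} {I : FinAlgebra F m}
          (χ : Hom A (FinAlg I)) (β : Congruence A r) → β ≤ᶜ ker χ →
          Hom (A / β) (FinAlg I)
quotHom χ β β≤ = record
  { func = Hom.func χ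
  ; func-cong = β≤
  ; func-hom = Hom.func-hom χ
  }

data COp (F : Signature) (m : ℕ) : Set where
  d   : COp F m
  hat : (f : Op F) → (Fin (arity F f) → Fin m) → COp F m

CSig : Signature → ℕ → Signature
CSig F m = record { Op = COp F m ; arity = ar }
  where
    ar : COp F m → ℕ
    ar d         = m
    ar (hat f _) = arity F f

module ℭConstruction {F : Signature} (nn : NoNullary F) {m : ℕ}
                     {b ℓ : Level} (B : Algebra F b ℓ) (I : FinAlgebra F m)
                     (ξ : Hom B (FinAlg I)) where
  private
    module B = Algebra B
    module I = FinAlgebra I
    module ξ = Hom ξ

  D : Fin m → Set b
  D i = Σ B.Carrier (λ x → ξ.func x ≡ i)

  Column : Set b
  Column = (i : Fin m) → D i

  replace : Column → (j : Fin m) → D j → Column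
  replace c j x i with i ≟ j
  ... | yes p = proj₁ x , ≡.trans (proj₂ x) (≡.sym p)
  ... | no _  = c i

  Lift : ∀ {r} → Rel B.Carrier r → Rel Column r
  Lift R c c′ = ∀ i → R (proj₁ (c i)) (proj₁ (c′ i))

  opC : (o : COp F m) → (Fin (arity (CSig F m) o) → Column) → Column
  opC d cs i = cs i i
  opC (hat f is) cs =
    replace (cs (first (nn f))) (I.op f is)
      ( B.⟦ f ⟧ (λ j → proj₁ (cs j (is j)))
      , ≡.trans (ξ.func-hom f (λ j → proj₁ (cs j (is j))))
                (I.op-cong f (λ j → proj₂ (cs j (is j)))) )

  opC-lift : ∀ {r} (R : Rel B.Carrier r) →
             (∀ f {xs ys : Fin (arity F f) → B.Carrier} →
                (∀ j → R (xs j) (ys j)) → R (B.⟦ f ⟧ xs) (B.⟦ f ⟧ ys)) →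
             ∀ o {cs cs′ : Fin (arity (CSig F m) o) → Column} →
             (∀ j → Lift R (cs j) (cs′ j)) → Lift R (opC o cs) (opC o cs′)
  opC-lift R comp d eq i = eq i i
  opC-lift R comp (hat f is) eq i with i ≟ I.op f is
  ... | yes p = comp f (λ j → eq j (is j))
  ... | no _  = eq (first (nn f)) i

  liftEquiv : ∀ {r} {R : Rel B.Carrier r} → IsEquivalence R → IsEquivalence (Lift R)
  liftEquiv e = record
    { refl = λ i → IsEquivalence.refl e
    ; sym = λ p i → IsEquivalence.sym e (p i)
    ; trans = λ p q i → IsEquivalence.trans e (p i) (q i)
    }

  ℭ : Algebra (CSig F m) b ℓ
  ℭ = record
    { Carrier = Column
    ; _≈_ = Lift B._≈_
    ; isEquivalence = liftEquiv B.isEquivalence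
    ; ⟦_⟧ = opC
    ; ⟦⟧-cong = opC-lift B._≈_ B.⟦⟧-cong
    }

  star : ∀ {r} (β : Congruence B r) → Congruence ℭ r
  star β = record
    { rel = Lift (Congruence.rel β)
    ; isEquivalence = liftEquiv (Congruence.isEquivalence β)
    ; ≈⊆rel = λ p i → Congruence.≈⊆rel β (p i)
    ; compatible = opC-lift (Congruence.rel β) (Congruence.compatible β)
    }

ℭ : ∀ {F : Signature} → NoNullary F → ∀ {m b ℓ} (B : Algebra F b ℓ)
    {I : FinAlgebra F m} → Hom B (FinAlg I) → Algebra (CSig F m) b ℓ
ℭ nn B {I} ξ = ℭConstruction.ℭ nn B I ξ

_* : ∀ {F : Signature} {nn : NoNullary F} {m b ℓ r} {B : Algebra F b ℓ}
     {I : FinAlgebra F m} {ξ : Hom B (FinAlg I)} →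
     Congruence B r → Congruence (ℭ nn B ξ) r
_* {nn = nn} {B = B} {I} {ξ} β = ℭConstruction.star nn B I ξ β

module Submission where

-- In the setoid encoding, A/β has the carrier and operations of A, and χ/β has
-- the underlying map of χ, so ℭ(A/β, χ/β) and ℭ(A, χ) have the same columns and
-- the same operations; equality in the former is the pointwise lift of β, which
-- is β*.  Hence the identity on columns is the isomorphism.

open import Level using (Level)
open import Data.Nat using (ℕ)
open import Data.Fin using (_≟_)
open import Relation.Binary using (IsEquivalence)
open import Relation.Nullary using (yes; no)
open import Defs

module _ {F : Signature} (nn : NoNullary F) {m : ℕ} (I : FinAlgebra F m)
         {a ℓ r : Level} (A : Algebra F a ℓ) (χ : Hom A (FinAlg I))
         (β : Congruence A r) (β≤α : β ≤ᶜ ker χ) where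

  private
    ℭ/ : Algebra (CSig F m) a r
    ℭ/ = ℭ nn (A / β) (quotHom χ β β≤α)

    ℭ* : Algebra (CSig F m) a r
    ℭ* = ℭ nn A χ / (_* {nn = nn} {ξ = χ} β)

    β-refl : ∀ {x} → Congruence.rel β x x
    β-refl = IsEquivalence.refl (Congruence.isEquivalence β)

  ℭ-quotient-op-≈ : ∀ o cs → Algebra._≈_ ℭ* (Algebra.⟦ ℭ/ ⟧ o cs) (Algebra.⟦ ℭ* ⟧ o cs)
  ℭ-quotient-op-≈ d          cs i = β-refl
  ℭ-quotient-op-≈ (hat f is) cs i with i ≟ FinAlgebra.op I f is
  ... | yes _ = β-refl
  ... | no _  = β-refl

  ℭ-quotient-idHom : Hom ℭ/ ℭ*
  ℭ-quotient-idHom = record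
    { func      = λ c → c
    ; func-cong = λ c≈c′ → c≈c′
    ; func-hom  = ℭ-quotient-op-≈
    }

  ℭ-quotient-idHom⁻¹ : Hom ℭ* ℭ/
  ℭ-quotient-idHom⁻¹ = record
    { func      = λ c → c
    ; func-cong = λ c≈c′ → c≈c′
    ; func-hom  = λ o cs i → IsEquivalence.sym (Congruence.isEquivalence β)
                                               (ℭ-quotient-op-≈ o cs i)
    }

  ℭ-quotient-≅ : ℭ/ ≅ ℭ*
  ℭ-quotient-≅ = record
    { to      = ℭ-quotient-idHom
    ; from    = ℭ-quotient-idHom⁻¹
    ; to∘from = λ _ _ → β-refl
    ; from∘to = λ _ _ → β-refl
    }

corollary3p5 : {F : Signature} (nn : NoNullary F) {m : ℕ} (I : FinAlgebra F m)
               {a ℓ r : Level} (A : Algebra F a ℓ) (χ : Hom A (FinAlg I)) →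
               Surjective χ →
               (β : Congruence A r) (β≤α : β ≤ᶜ ker χ) →
               ℭ nn (A / β) (quotHom χ β β≤α) ≅ (ℭ nn A χ / (_* {nn = nn} {ξ = χ} β))
corollary3p5 nn I A χ _ β β≤α = ℭ-quotient-≅ nn I A χ β β≤α
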